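{- Fix $k\geq 1$. For all integers $n\ge k-1$, $$W_{n+2,k}(x)=\frac{(n+2)\left(2(n-k+1)-(n-2k+1)x\right)}{(n-k+2)(n-k+3)}W_{n+1,k}(x)+\frac{(n+1)(n+2)(n-k)(x-1)}{(n-k+2)^2(n-k+3)}W_{n,k}(x),$$ where $W_{n,k}(x)=\sum_{m=0}^{k}w_{n,k,m}x^m$.
   Context: For integers $n,k,m$ (with $k\ge1$) define $w_{n,k,m}=\frac{1}{k}\binom{n}{k-1}\binom{n-k-1}{m-1}\binom{k}{m}$ if $0<m\le k$ and $k+m\le n$; $w_{n,k,m}=1$ if $m=0$ and $n=k$; and $w_{n,k,m}=0$ otherwise. (Combinatorially, $w_{n,k,m}$ is the number of Dyck paths of semilength $n$ with $k$ occurrences of $UD$ and $m$ occurrences of $UUD$.) -}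

module Defs where

open import Data.Nat as ℕ using (ℕ; zero; suc; _∸_; _≤_; _<_)
open import Data.Nat.Combinatorics using (_C_)
open import Data.Integer as ℤ using (ℤ; +_)
open import Data.Rational using (ℚ; _/_; 0ℚ; 1ℚ; _+_; _*_; ≢-nonZero; _÷_)
open import Data.Rational.Properties using (_≟_)
open import Data.List using (List; map; upTo; foldr)
open import Relation.Nullary using (yes; no)
open import Relation.Nullary.Decidable using (⌊_⌋)
open import Data.Bool using (if_then_else_; _∧_)

ℤ→ℚ : ℤ → ℚ
ℤ→ℚ z = z / 1

ℕ→ℚ : ℕ → ℚ
ℕ→ℚ n = + n / 1

-- Total division on ℚ: p ÷ₜ q = p / q when q ≠ 0 (and 0 when q = 0;
-- this case never arises in the theorem, all denominators are positive).
_÷ₜ_ : ℚ → ℚ → ℚ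
p ÷ₜ q with q ≟ 0ℚ
... | yes _ = 0ℚ
... | no q≢0 = _÷_ p q {{≢-nonZero q≢0}}

_^_ : ℚ → ℕ → ℚ
x ^ zero = 1ℚ
x ^ suc m = x * (x ^ m)

sumℚ : List ℚ → ℚ
sumℚ = foldr _+_ 0ℚ

-- w_{n,k,m} for natural n, k, m (k ≥ 1 in all uses):
--   (1/k) C(n,k-1) C(n-k-1,m-1) C(k,m)  if 0 < m ≤ k and k + m ≤ n
--   1                                    if m = 0 and n = k
--   0                                    otherwise
-- (In the first case n - k - 1 ≥ m - 1 ≥ 0, so truncated subtraction is exact.)
w : ℕ → ℕ → ℕ → ℚ
w n k m =
  if ⌊ 1 ℕ.≤? m ⌋ ∧ ⌊ m ℕ.≤? k ⌋ ∧ ⌊ k ℕ.+ m ℕ.≤? n ⌋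
  then ℕ→ℚ ((n C (k ∸ 1)) ℕ.* ((n ∸ k ∸ 1) C (m ∸ 1)) ℕ.* (k C m)) ÷ₜ ℕ→ℚ k
  else (if ⌊ m ℕ.≟ 0 ⌋ ∧ ⌊ n ℕ.≟ k ⌋ then 1ℚ else 0ℚ)

W : ℕ → ℕ → ℚ → ℚ
W n k x = sumℚ (map (λ m → w n k m * (x ^ m)) (upTo (suc k)))

module Submission where

open import Algebra using (Ring; CommutativeMonoid)
open import Data.List using (_∷_; [])
open import Data.Nat as ℕ using (ℕ; zero; suc; _≤_; _∸_; s≤s)
import Data.Nat.Properties as ℕ
open import Data.Nat.Combinatorics using (_C_; nC1≡n; nCk≡nC[n∸k]; nCk+nC[k+1]≡[n+1]C[k+1]; k>n⇒nCk≡0)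
open import Data.Product using (∃; _,_)
open import Function using (_∘_; _∋_)
open import Relation.Nullary using (yes; no; contradiction)
open import Relation.Binary.PropositionalEquality
open import Defs

-- w(n,k,m) = C(n,k−1)·C(k,m)·G(n−k+1,m)/k, where G(e,m) = compositions e m counts the compositions
-- of e − 1 into m parts.  Multiplied by k(n−k+2)²(n−k+3), the recurrence becomes an identity between
-- polynomials in x with integer coefficients, proved coefficientwise.  As (n−k+2)·C(n+1,k−1) equals
-- (n+1)·C(n,k−1), the coefficient of x^m is C(n,k−1)(n+1)(n+2) times an identity involving only G and
-- C(k,m), which follows from Pascal's rule for G and the absorption identities
-- j·G(e+1,j+1) = (e−1)·G(e,j) and (j+1)·C(k,j+1) = (k−j)·C(k,j).

-- With the ring solver proving x − y ≡ a − b, this derives x ≡ y from a combination a ≡ b of hypotheses.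
module _ {c ℓ} (R : Ring c ℓ) where
  open Ring R using (_≈_; _-_; +-group) renaming (trans to ≈-trans)
  open import Algebra.Properties.Group +-group using (x∙y⁻¹≈ε⇒x≈y; x≈y⇒x∙y⁻¹≈ε)

  by-difference : ∀ {x y a b} → a ≈ b → x - y ≈ a - b → x ≈ y
  by-difference a≈b x-y≈a-b = x∙y⁻¹≈ε⇒x≈y _ _ (≈-trans x-y≈a-b (x≈y⇒x∙y⁻¹≈ε a≈b))

module Coefficients where
  open import Data.Integer using (ℤ; +_; 0ℤ; _+_; _*_; _-_)
  import Data.Integer.Properties as ℤ
  open import Data.Integer.Tactic.RingSolver using (solve; solve-∀)
  open ≡-Reasoning

  by-differenceℤ : ∀ {x y a b : ℤ} → a ≡ b → x - y ≡ a - b → x ≡ y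
  by-differenceℤ = by-difference ℤ.+-*-ring

  [1+k]*[1+n]C[1+k]≡[1+n]*nCk : ∀ n k → + suc k * + (suc n C suc k) ≡ + suc n * + (n C k)
  [1+k]*[1+n]C[1+k]≡[1+n]*nCk zero    zero    = refl
  [1+k]*[1+n]C[1+k]≡[1+n]*nCk zero    (suc k) = ℤ.*-zeroʳ (+ suc (suc k))
  [1+k]*[1+n]C[1+k]≡[1+n]*nCk (suc n) zero    = begin
    + 1 * + (suc (suc n) C 1) ≡⟨ ℤ.*-identityˡ _ ⟩
    + (suc (suc n) C 1)       ≡⟨ cong +_ (nC1≡n (suc (suc n))) ⟩
    + suc (suc n)             ≡⟨ ℤ.*-identityʳ _ ⟨
    + suc (suc n) * + 1       ∎
  [1+k]*[1+n]C[1+k]≡[1+n]*nCk (suc n) (suc k) =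
    step (+ n) (+ k) _ _ _ _ _ ([1+k]*[1+n]C[1+k]≡[1+n]*nCk n k) ([1+k]*[1+n]C[1+k]≡[1+n]*nCk n (suc k))
         (cong +_ (nCk+nC[k+1]≡[n+1]C[k+1] n k)) (cong +_ (nCk+nC[k+1]≡[n+1]C[k+1] (suc n) (suc k)))
    where
    step : ∀ n k a b x y z → (+ 1 + k) * x ≡ (+ 1 + n) * a → (+ 2 + k) * y ≡ (+ 1 + n) * b →
           a + b ≡ x → x + y ≡ z → (+ 2 + k) * z ≡ (+ 2 + n) * x
    step n k a b x y z hx hy hxy hz = begin
      (+ 2 + k) * z                     ≡⟨ cong ((+ 2 + k) *_) hz ⟨
      (+ 2 + k) * (x + y)               ≡⟨ solve (k ∷ x ∷ y ∷ []) ⟩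
      (+ 1 + k) * x + (+ 2 + k) * y + x ≡⟨ cong₂ (λ u v → u + v + x) hx hy ⟩
      (+ 1 + n) * a + (+ 1 + n) * b + x ≡⟨ solve (n ∷ a ∷ b ∷ x ∷ []) ⟩
      (+ 1 + n) * (a + b) + x           ≡⟨ cong (λ u → (+ 1 + n) * u + x) hxy ⟩
      (+ 1 + n) * x + x                 ≡⟨ solve (n ∷ x ∷ []) ⟩
      (+ 2 + n) * x                     ∎

  [1+n-k]*[1+n]Ck≡[1+n]*nCk : ∀ n k → (+ suc n - + k) * + (suc n C k) ≡ + suc n * + (n C k)
  [1+n-k]*[1+n]Ck≡[1+n]*nCk n zero    = cong (_* + 1) (ℤ.+-identityʳ (+ suc n))
  [1+n-k]*[1+n]Ck≡[1+n]*nCk n (suc k) =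
    step (+ n) (+ k) _ _ _ ([1+k]*[1+n]C[1+k]≡[1+n]*nCk n k) (cong +_ (nCk+nC[k+1]≡[n+1]C[k+1] n k))
    where
    step : ∀ n k a b x → (+ 1 + k) * x ≡ (+ 1 + n) * a → a + b ≡ x → (+ 1 + n - (+ 1 + k)) * x ≡ (+ 1 + n) * b
    step n k a b x hx hab = begin
      (+ 1 + n - (+ 1 + k)) * x           ≡⟨ solve (n ∷ k ∷ x ∷ []) ⟩
      (+ 1 + n) * x - (+ 1 + k) * x       ≡⟨ cong₂ (λ u v → (+ 1 + n) * u - v) hab (sym hx) ⟨
      (+ 1 + n) * (a + b) - (+ 1 + n) * a ≡⟨ solve (n ∷ a ∷ b ∷ []) ⟩
      (+ 1 + n) * b                       ∎

  [1+n]Cn≡1+n : ∀ n → suc n C n ≡ suc n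
  [1+n]Cn≡1+n n = begin
    suc n C n             ≡⟨ nCk≡nC[n∸k] (ℕ.n≤1+n n) ⟩
    suc n C (suc n ∸ n)   ≡⟨ cong (suc n C_) (ℕ.m+n∸n≡m 1 n) ⟩
    suc n C 1             ≡⟨ nC1≡n (suc n) ⟩
    suc n                 ∎

  -- The compositions of e − 1 into m positive parts (none for e = 0), indexed by e = n − k + 1 so that
  -- the weights vanish at n = k − 1 and Pascal's rule holds for all e.
  compositions : ℕ → ℕ → ℕ
  compositions zero          _       = 0
  compositions (suc e)       (suc j) = compositions e j ℕ.+ compositions e (suc j)
  compositions (suc zero)    zero    = 1
  compositions (suc (suc _)) zero    = 0

  compositions-closed : ∀ e j → compositions (suc (suc e)) (suc j) ≡ e C j
  compositions-closed zero    zero    = refl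
  compositions-closed zero    (suc j) = refl
  compositions-closed (suc e) zero    = compositions-closed e zero
  compositions-closed (suc e) (suc j) =
    trans (cong₂ ℕ._+_ (compositions-closed e j) (compositions-closed e (suc j))) (nCk+nC[k+1]≡[n+1]C[k+1] e j)

  compositions-vanish : ∀ {e j} → e ≤ suc j → compositions e (suc j) ≡ 0
  compositions-vanish {zero}          _         = refl
  compositions-vanish {suc zero}      _         = refl
  compositions-vanish {suc (suc e)} {j} (s≤s e<j) = trans (compositions-closed e j) (k>n⇒nCk≡0 e<j)

  compositions-absorption : ∀ e j → + j * + compositions (suc e) (suc j) ≡ (+ e - + 1) * + compositions e j
  compositions-absorption zero          j       = ℤ.*-zeroʳ (+ j)
  compositions-absorption (suc zero)    zero    = refl
  compositions-absorption (suc (suc e)) zero    = sym (ℤ.*-zeroʳ (+ suc e))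
  compositions-absorption (suc e)       (suc j) =
    step (+ e) (+ j) _ _ _ (compositions-absorption e j) (compositions-absorption e (suc j))
    where
    step : ∀ e j x y u → j * (x + y) ≡ (e - + 1) * x → (+ 1 + j) * u ≡ (e - + 1) * y →
           (+ 1 + j) * ((x + y) + u) ≡ (+ 1 + e - + 1) * (x + y)
    step e j x y u hx hu = begin
      (+ 1 + j) * ((x + y) + u)               ≡⟨ solve (j ∷ x ∷ y ∷ u ∷ []) ⟩
      j * (x + y) + (+ 1 + j) * u + (x + y)   ≡⟨ cong₂ (λ a b → a + b + (x + y)) hx hu ⟩
      (e - + 1) * x + (e - + 1) * y + (x + y) ≡⟨ solve (e ∷ x ∷ y ∷ []) ⟩
      (+ 1 + e - + 1) * (x + y)               ∎

  -- k·w(n,k,m) for k = K + 1 and n = e + K, as a product of integers (see k*w≡weight).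
  weight : ℕ → ℕ → ℕ → ℤ
  weight K e m = + ((e ℕ.+ K) C K) * (+ compositions e m * + (suc K C m))

  +-weight : ∀ K e m → + (((e ℕ.+ K) C K) ℕ.* compositions e m ℕ.* (suc K C m)) ≡ weight K e m
  +-weight K e m = trans (cong +_ (ℕ.*-assoc ((e ℕ.+ K) C K) (compositions e m) (suc K C m)))
    (trans (ℤ.pos-* ((e ℕ.+ K) C K) _) (cong (+ ((e ℕ.+ K) C K) *_) (ℤ.pos-* (compositions e m) (suc K C m))))

  compositions≡0⇒weight≡0 : ∀ K e m → compositions e m ≡ 0 → weight K e m ≡ 0ℤ
  compositions≡0⇒weight≡0 K e m G≡0 =
    trans (cong (λ g → + ((e ℕ.+ K) C K) * (+ g * + (suc K C m))) G≡0) (ℤ.*-zeroʳ (+ ((e ℕ.+ K) C K)))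

  C≡0⇒weight≡0 : ∀ K e m → suc K C m ≡ 0 → weight K e m ≡ 0ℤ
  C≡0⇒weight≡0 K e m Z≡0 = trans (cong (λ z → + ((e ℕ.+ K) C K) * (+ compositions e m * + z)) Z≡0)
    (trans (cong (+ ((e ℕ.+ K) C K) *_) (ℤ.*-zeroʳ (+ compositions e m))) (ℤ.*-zeroʳ (+ ((e ℕ.+ K) C K))))

  shift : (ℕ → ℤ) → ℕ → ℤ
  shift f zero    = 0ℤ
  shift f (suc m) = f m

  -- Cleared of denominators, the theorem reads a² b W(n+2) = a (p₀ − p₁ x) W(n+1) + r (x − 1) W(n).
  a b p₀ p₁ r : ℕ → ℕ → ℤ
  a  n k = + n - + k + + 2
  b  n k = + n - + k + + 3
  p₀ n k = + (n ℕ.+ 2) * (+ 2 * (+ n - + k + + 1))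
  p₁ n k = + (n ℕ.+ 2) * (+ n - + 2 * + k + + 1)
  r  n k = (+ n + + 1) * (+ n + + 2) * (+ n - + k)

  a≡1+d : ∀ d K → a (d ℕ.+ K) (suc K) ≡ + suc d
  a≡1+d d K = identity (+ d) (+ K)
    where
    identity : ∀ d K → d + K - (+ 1 + K) + + 2 ≡ + 1 + d
    identity = solve-∀

  b≡2+d : ∀ d K → b (d ℕ.+ K) (suc K) ≡ + suc (suc d)
  b≡2+d d K = identity (+ d) (+ K)
    where
    identity : ∀ d K → d + K - (+ 1 + K) + + 3 ≡ + 2 + d
    identity = solve-∀

  -- Stated over independent integers for the ring solver; at d, K := + d, + K the coefficients below
  -- are definitionally a, b, p₀, p₁, r at n = d + K, k = 1 + K.
  recurrence-from-reduced : ∀ d K c₀ c₁ c₂ X₂ X₁ X₁′ X₀′ X₀ →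
    (+ 1 + (d + K) - K) * c₁ ≡ (+ 1 + (d + K)) * c₀ →
    (+ 1 + (+ 1 + d + K) - K) * c₂ ≡ (+ 1 + (+ 1 + d + K)) * c₁ →
    (d + + 1) * X₂ ≡ + 2 * d * X₁ - (d - K - + 1) * X₁′ + (d - + 1) * (X₀′ - X₀) →
    let n = d + K; k = + 1 + K in
    (n - k + + 2) * (n - k + + 2) * (n - k + + 3) * (c₂ * X₂) ≡
    (n - k + + 2) * ((n + + 2) * (+ 2 * (n - k + + 1)) * (c₁ * X₁) - (n + + 2) * (n - + 2 * k + + 1) * (c₁ * X₁′))
    + (n + + 1) * (n + + 2) * (n - k) * (c₀ * X₀′ - c₀ * X₀)
  recurrence-from-reduced d K c₀ c₁ c₂ X₂ X₁ X₁′ X₀′ X₀ hc₁ hc₂ hX = by-differenceℤ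
    (cong₂ _+_ (cong₂ (λ u v → (d + + 1) * (d + + 1) * X₂ * u
                              + (d + K + + 2) * ((d + + 1) * X₂ - + 2 * d * X₁ + (d - K - + 1) * X₁′) * v) hc₂ hc₁)
               (cong ((d + K + + 1) * (d + K + + 2) * c₀ *_) hX))
    (solve (d ∷ K ∷ c₀ ∷ c₁ ∷ c₂ ∷ X₂ ∷ X₁ ∷ X₁′ ∷ X₀′ ∷ X₀ ∷ []))

  reduced-recurrence : ∀ d K j z₀ z₁ g₀₀ g₀₁ g₁₀ →
    (+ 1 + j) * z₁ ≡ (+ 1 + K - j) * z₀ →
    j * (g₀₀ + g₀₁) ≡ (d - + 1) * g₀₀ →
    j * (g₁₀ + (g₀₀ + g₀₁)) ≡ (+ 1 + d - + 1) * g₁₀ →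
    (d + + 1) * ((g₁₀ + (g₀₀ + g₀₁)) * z₁) ≡
    + 2 * d * ((g₀₀ + g₀₁) * z₁) - (d - K - + 1) * (g₁₀ * z₀) + (d - + 1) * (g₀₀ * z₀ - g₀₁ * z₁)
  reduced-recurrence d K j z₀ z₁ g₀₀ g₀₁ g₁₀ hz hg₀ hg₁ = by-differenceℤ
    (cong₂ _+_ (cong₂ (λ u v → (z₁ + z₀) * (u - v)) hg₀ hg₁) (cong (g₁₀ *_) hz))
    (solve (d ∷ K ∷ j ∷ z₀ ∷ z₁ ∷ g₀₀ ∷ g₀₁ ∷ g₁₀ ∷ []))

  recurrence-at-zero : ∀ d K c₀ c₁ c₂ g₀ g₁ → + 0 ≡ (d - + 1) * g₀ → + 0 ≡ (+ 1 + d - + 1) * g₁ →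
    let n = d + K; k = + 1 + K in
    (n - k + + 2) * (n - k + + 2) * (n - k + + 3) * (c₂ * (+ 0 * + 1)) ≡
    (n - k + + 2) * ((n + + 2) * (+ 2 * (n - k + + 1)) * (c₁ * (g₁ * + 1)) - (n + + 2) * (n - + 2 * k + + 1) * 0ℤ)
    + (n + + 1) * (n + + 2) * (n - k) * (0ℤ - c₀ * (g₀ * + 1))
  recurrence-at-zero d K c₀ c₁ c₂ g₀ g₁ hg₀ hg₁ = by-differenceℤ
    (cong₂ (λ u v → + 2 * (d + + 1) * (d + K + + 2) * c₁ * u - (d + K + + 1) * (d + K + + 2) * c₀ * v) hg₁ hg₀)
    (solve (d ∷ K ∷ c₀ ∷ c₁ ∷ c₂ ∷ g₀ ∷ g₁ ∷ []))

  weight-recurrence : ∀ K d m → let n = d ℕ.+ K; k = suc K in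
    a n k * a n k * b n k * weight K (2 ℕ.+ d) m ≡
    a n k * (p₀ n k * weight K (1 ℕ.+ d) m - p₁ n k * shift (weight K (1 ℕ.+ d)) m)
    + r n k * (shift (weight K d) m - weight K d m)
  weight-recurrence K d zero =
    recurrence-at-zero (+ d) (+ K) (c d) (c (1 ℕ.+ d)) (c (2 ℕ.+ d)) (g d 0) (g (1 ℕ.+ d) 0)
      (compositions-absorption d 0) (compositions-absorption (suc d) 0)
    where
    c : ℕ → ℤ
    c e = + ((e ℕ.+ K) C K)
    g : ℕ → ℕ → ℤ
    g e m = + compositions e m
  weight-recurrence K d (suc j) =
    recurrence-from-reduced (+ d) (+ K) _ _ _ _ _ _ _ _
      ([1+n-k]*[1+n]Ck≡[1+n]*nCk (d ℕ.+ K) K) ([1+n-k]*[1+n]Ck≡[1+n]*nCk (suc d ℕ.+ K) K)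
      (reduced-recurrence (+ d) (+ K) (+ j) _ _
        (+ compositions d j) (+ compositions d (suc j)) (+ compositions (suc d) j)
        (trans ([1+k]*[1+n]C[1+k]≡[1+n]*nCk K j) (sym ([1+n-k]*[1+n]Ck≡[1+n]*nCk K j)))
        (compositions-absorption d j) (compositions-absorption (suc d) j))

module Rationals where
  open import Level using (0ℓ)
  open import Data.Integer as ℤ using (+_)
  import Data.Integer.Properties as ℤ
  open import Data.Integer.Tactic.RingSolver as ℤ-Solver using ()
  open import Data.Rational as ℚ using (ℚ; 0ℚ; _+_; _*_; _-_; -_; 1/_; ≢-nonZero; toℚᵘ)
  import Data.Rational.Properties as ℚ
  open import Data.Rational.Unnormalised as ℚᵘ using (mkℚᵘ; *≡*)
  import Data.Rational.Unnormalised.Properties as ℚᵘ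
  open import Relation.Nullary.Decidable using (dec⇒maybe)
  import Tactic.RingSolver.Core.AlmostCommutativeRing as ACR
  open import Algebra.Properties.CommutativeSemigroup (CommutativeMonoid.commutativeSemigroup ℚ.*-1-commutativeMonoid)
    using (x∙yz≈y∙xz)

  ℚ-ring : ACR.AlmostCommutativeRing 0ℓ 0ℓ
  ℚ-ring = ACR.fromCommutativeRing ℚ.+-*-commutativeRing (λ q → dec⇒maybe (0ℚ ℚ.≟ q))

  by-differenceℚ : ∀ {x y u v : ℚ} → u ≡ v → x - y ≡ u - v → x ≡ y
  by-differenceℚ = by-difference ℚ.+-*-ring

  ℤ→ℚ≃mkℚᵘ : ∀ i → toℚᵘ (ℤ→ℚ i) ℚᵘ.≃ mkℚᵘ i 0
  ℤ→ℚ≃mkℚᵘ i = ℚ.toℚᵘ-fromℚᵘ (mkℚᵘ i 0)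

  ℤ→ℚ-homo-+ : ∀ i j → ℤ→ℚ (i ℤ.+ j) ≡ ℤ→ℚ i + ℤ→ℚ j
  ℤ→ℚ-homo-+ i j = ℚ.toℚᵘ-injective (begin
    toℚᵘ (ℤ→ℚ (i ℤ.+ j))                ≈⟨ ℤ→ℚ≃mkℚᵘ (i ℤ.+ j) ⟩
    mkℚᵘ (i ℤ.+ j) 0                     ≈⟨ *≡* (cross-multiplied i j) ⟩
    mkℚᵘ i 0 ℚᵘ.+ mkℚᵘ j 0               ≈⟨ ℚᵘ.+-cong (ℤ→ℚ≃mkℚᵘ i) (ℤ→ℚ≃mkℚᵘ j) ⟨
    toℚᵘ (ℤ→ℚ i) ℚᵘ.+ toℚᵘ (ℤ→ℚ j)       ≈⟨ ℚ.toℚᵘ-homo-+ (ℤ→ℚ i) (ℤ→ℚ j) ⟨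
    toℚᵘ (ℤ→ℚ i + ℤ→ℚ j)                 ∎)
    where
    open ℚᵘ.≃-Reasoning
    cross-multiplied : ∀ i j → (i ℤ.+ j) ℤ.* + 1 ≡ (i ℤ.* + 1 ℤ.+ j ℤ.* + 1) ℤ.* + 1
    cross-multiplied = ℤ-Solver.solve-∀

  ℤ→ℚ-homo-* : ∀ i j → ℤ→ℚ (i ℤ.* j) ≡ ℤ→ℚ i * ℤ→ℚ j
  ℤ→ℚ-homo-* i j = ℚ.toℚᵘ-injective (begin
    toℚᵘ (ℤ→ℚ (i ℤ.* j))                ≈⟨ ℤ→ℚ≃mkℚᵘ (i ℤ.* j) ⟩
    mkℚᵘ (i ℤ.* j) 0                     ≈⟨ ℚᵘ.*-cong (ℤ→ℚ≃mkℚᵘ i) (ℤ→ℚ≃mkℚᵘ j) ⟨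
    toℚᵘ (ℤ→ℚ i) ℚᵘ.* toℚᵘ (ℤ→ℚ j)       ≈⟨ ℚ.toℚᵘ-homo-* (ℤ→ℚ i) (ℤ→ℚ j) ⟨
    toℚᵘ (ℤ→ℚ i * ℤ→ℚ j)                 ∎)
    where open ℚᵘ.≃-Reasoning

  ℤ→ℚ-homo‿- : ∀ i → ℤ→ℚ (ℤ.- i) ≡ - ℤ→ℚ i
  ℤ→ℚ-homo‿- i = ℚ.toℚᵘ-injective (begin
    toℚᵘ (ℤ→ℚ (ℤ.- i))     ≈⟨ ℤ→ℚ≃mkℚᵘ (ℤ.- i) ⟩
    mkℚᵘ (ℤ.- i) 0          ≈⟨ ℚᵘ.-‿cong (ℤ→ℚ≃mkℚᵘ i) ⟨
    ℚᵘ.- toℚᵘ (ℤ→ℚ i)       ≈⟨ ℚ.toℚᵘ-homo‿- (ℤ→ℚ i) ⟨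
    toℚᵘ (- ℤ→ℚ i)          ∎)
    where open ℚᵘ.≃-Reasoning

  ℤ→ℚ-homo-− : ∀ i j → ℤ→ℚ (i ℤ.- j) ≡ ℤ→ℚ i - ℤ→ℚ j
  ℤ→ℚ-homo-− i j = trans (ℤ→ℚ-homo-+ i (ℤ.- j)) (cong (λ q → ℤ→ℚ i + q) (ℤ→ℚ-homo‿- j))

  ℤ→ℚ-injective : ∀ {i j} → ℤ→ℚ i ≡ ℤ→ℚ j → i ≡ j
  ℤ→ℚ-injective {i} {j} eq with ℚᵘ.≃-trans (ℚᵘ.≃-sym (ℤ→ℚ≃mkℚᵘ i)) (ℚᵘ.≃-trans (ℚ.toℚᵘ-cong eq) (ℤ→ℚ≃mkℚᵘ j))
  ... | *≡* i*1≡j*1 = trans (sym (ℤ.*-identityʳ i)) (trans i*1≡j*1 (ℤ.*-identityʳ j))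

  i≢0⇒ℤ→ℚ≢0 : ∀ {i} → i ≢ + 0 → ℤ→ℚ i ≢ 0ℚ
  i≢0⇒ℤ→ℚ≢0 i≢0 = i≢0 ∘ ℤ→ℚ-injective

  ℕ→ℚ[1+n]≢0 : ∀ n → ℕ→ℚ (suc n) ≢ 0ℚ
  ℕ→ℚ[1+n]≢0 n = i≢0⇒ℤ→ℚ≢0 {+ suc n} λ ()

  q*[p÷ₜq]≡p : ∀ p {q} → q ≢ 0ℚ → q * (p ÷ₜ q) ≡ p
  q*[p÷ₜq]≡p p {q} q≢0 with q ℚ.≟ 0ℚ
  ... | yes q≡0  = contradiction q≡0 q≢0
  ... | no  q≢0′ = trans (x∙yz≈y∙xz q p (1/ q)) (trans (cong (p *_) (ℚ.*-inverseʳ q)) (ℚ.*-identityʳ p))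
    where instance _ = ≢-nonZero q≢0′

  *-cancelˡ-≢0 : ∀ {q u v} → q ≢ 0ℚ → q * u ≡ q * v → u ≡ v
  *-cancelˡ-≢0 {q} q≢0 qu≡qv = trans (sym (inverse-cancels _)) (trans (cong (1/ q *_) qu≡qv) (inverse-cancels _))
    where
    instance _ = ≢-nonZero q≢0
    inverse-cancels : ∀ u → 1/ q * (q * u) ≡ u
    inverse-cancels u = trans (sym (ℚ.*-assoc (1/ q) q u)) (trans (cong (_* u) (ℚ.*-inverseˡ q)) (ℚ.*-identityˡ u))

module Polynomials where
  open import Data.Integer as ℤ using (ℤ; +_; 0ℤ)
  import Data.Integer.Properties as ℤ
  open import Data.List using (applyUpTo)
  open import Data.List.Properties using (map-upTo)
  open import Data.Rational as ℚ using (ℚ; 0ℚ; 1ℚ; _+_; _*_; _-_; -_)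
  import Data.Rational.Properties as ℚ
  open import Tactic.RingSolver using (solve)
  open import Algebra.Properties.CommutativeSemigroup (CommutativeMonoid.commutativeSemigroup ℚ.+-0-commutativeMonoid)
    using (interchange)
  open import Algebra.Properties.CommutativeSemigroup (CommutativeMonoid.commutativeSemigroup ℚ.*-1-commutativeMonoid)
    using (x∙yz≈y∙xz)
  open Coefficients
  open Rationals
  open ≡-Reasoning

  Σ< : ℕ → (ℕ → ℚ) → ℚ
  Σ< L f = sumℚ (applyUpTo f L)

  Σ<-cong : ∀ L {f g} → (∀ m → f m ≡ g m) → Σ< L f ≡ Σ< L g
  Σ<-cong zero    f≗g = refl
  Σ<-cong (suc L) f≗g = cong₂ _+_ (f≗g 0) (Σ<-cong L (f≗g ∘ suc))

  *-distribˡ-Σ< : ∀ c L f → c * Σ< L f ≡ Σ< L (λ m → c * f m)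
  *-distribˡ-Σ< c zero    f = ℚ.*-zeroʳ c
  *-distribˡ-Σ< c (suc L) f =
    trans (ℚ.*-distribˡ-+ c (f 0) _) (cong (λ s → c * f 0 + s) (*-distribˡ-Σ< c L (f ∘ suc)))

  Σ<-+ : ∀ L f g → Σ< L (λ m → f m + g m) ≡ Σ< L f + Σ< L g
  Σ<-+ zero    f g = refl
  Σ<-+ (suc L) f g =
    trans (cong (λ s → f 0 + g 0 + s) (Σ<-+ L (f ∘ suc) (g ∘ suc))) (interchange (f 0) (g 0) _ _)

  Σ<-neg : ∀ L f → Σ< L (λ m → - f m) ≡ - Σ< L f
  Σ<-neg zero    f = refl
  Σ<-neg (suc L) f = trans (cong (λ s → - f 0 + s) (Σ<-neg L (f ∘ suc))) (sym (ℚ.neg-distrib-+ (f 0) _))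

  Σ<-− : ∀ L f g → Σ< L (λ m → f m - g m) ≡ Σ< L f - Σ< L g
  Σ<-− L f g = trans (Σ<-+ L f (λ m → - g m)) (cong (λ s → Σ< L f + s) (Σ<-neg L g))

  Σ<-last : ∀ L f → Σ< (suc L) f ≡ Σ< L f + f L
  Σ<-last zero    f = ℚ.+-comm (f 0) 0ℚ
  Σ<-last (suc L) f = trans (cong (λ s → f 0 + s) (Σ<-last L (f ∘ suc))) (sym (ℚ.+-assoc (f 0) _ _))

  Σ<-recurrence : ∀ L (t : ℕ → ℚ) {δ α p q ρ : ℚ} (u₂ u₁ v₁ v₀ u₀ : ℕ → ℚ) →
    (∀ m → δ * u₂ m ≡ α * (p * u₁ m - q * v₁ m) + ρ * (v₀ m - u₀ m)) →
    δ * Σ< L (λ m → u₂ m * t m) ≡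
    α * (p * Σ< L (λ m → u₁ m * t m) - q * Σ< L (λ m → v₁ m * t m))
    + ρ * (Σ< L (λ m → v₀ m * t m) - Σ< L (λ m → u₀ m * t m))
  Σ<-recurrence L t {δ} {α} {p} {q} {ρ} u₂ u₁ v₁ v₀ u₀ rel = begin
    δ * Σ< L (λ m → u₂ m * t m)
      ≡⟨ *-distribˡ-Σ< δ L _ ⟩
    Σ< L (λ m → δ * (u₂ m * t m))
      ≡⟨ Σ<-cong L (λ m → scaled (u₂ m) (u₁ m) (v₁ m) (v₀ m) (u₀ m) (t m) (rel m)) ⟩
    Σ< L (λ m → α * (p * (u₁ m * t m) - q * (v₁ m * t m)) + ρ * (v₀ m * t m - u₀ m * t m))
      ≡⟨ Σ<-+ L _ _ ⟩
    Σ< L (λ m → α * (p * (u₁ m * t m) - q * (v₁ m * t m))) + Σ< L (λ m → ρ * (v₀ m * t m - u₀ m * t m))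
      ≡⟨ cong₂ _+_ (*-distribˡ-Σ< α L _) (*-distribˡ-Σ< ρ L _) ⟨
    α * Σ< L (λ m → p * (u₁ m * t m) - q * (v₁ m * t m)) + ρ * Σ< L (λ m → v₀ m * t m - u₀ m * t m)
      ≡⟨ cong₂ (λ X Y → α * X + ρ * Y) (Σ<-− L _ _) (Σ<-− L _ _) ⟩
    α * (Σ< L (λ m → p * (u₁ m * t m)) - Σ< L (λ m → q * (v₁ m * t m)))
    + ρ * (Σ< L (λ m → v₀ m * t m) - Σ< L (λ m → u₀ m * t m))
      ≡⟨ cong₂ (λ X Y → α * (X - Y) + ρ * _) (*-distribˡ-Σ< p L _) (*-distribˡ-Σ< q L _) ⟨
    α * (p * Σ< L (λ m → u₁ m * t m) - q * Σ< L (λ m → v₁ m * t m))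
    + ρ * (Σ< L (λ m → v₀ m * t m) - Σ< L (λ m → u₀ m * t m)) ∎
    where
    scaled : ∀ a₂ a₁ b₁ b₀ a₀ τ → δ * a₂ ≡ α * (p * a₁ - q * b₁) + ρ * (b₀ - a₀) →
             δ * (a₂ * τ) ≡ α * (p * (a₁ * τ) - q * (b₁ * τ)) + ρ * (b₀ * τ - a₀ * τ)
    scaled a₂ a₁ b₁ b₀ a₀ τ h =
      by-differenceℚ (cong (_* τ) h) (solve (δ ∷ α ∷ p ∷ q ∷ ρ ∷ a₂ ∷ a₁ ∷ b₁ ∷ b₀ ∷ a₀ ∷ τ ∷ []) ℚ-ring)

  poly : (ℕ → ℤ) → ℕ → ℚ → ℚ
  poly f L x = Σ< L (λ m → ℤ→ℚ (f m) * x ^ m)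

  poly-shift : ∀ f L x → poly (shift f) (suc L) x ≡ x * poly f L x
  poly-shift f L x = begin
    0ℚ * 1ℚ + Σ< L (λ m → ℤ→ℚ (f m) * (x * x ^ m))   ≡⟨ ℚ.+-identityˡ _ ⟩
    Σ< L (λ m → ℤ→ℚ (f m) * (x * x ^ m))             ≡⟨ Σ<-cong L (λ m → x∙yz≈y∙xz (ℤ→ℚ (f m)) x (x ^ m)) ⟩
    Σ< L (λ m → x * (ℤ→ℚ (f m) * x ^ m))             ≡⟨ *-distribˡ-Σ< x L _ ⟨
    x * poly f L x                                    ∎

  poly-top-zero : ∀ f L x → f L ≡ 0ℤ → poly f (suc L) x ≡ poly f L x
  poly-top-zero f L x fL≡0 = begin
    poly f (suc L) x                 ≡⟨ Σ<-last L _ ⟩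
    poly f L x + ℤ→ℚ (f L) * x ^ L   ≡⟨ cong (λ c → poly f L x + ℤ→ℚ c * x ^ L) fL≡0 ⟩
    poly f L x + 0ℚ * x ^ L          ≡⟨ cong (λ s → poly f L x + s) (ℚ.*-zeroˡ (x ^ L)) ⟩
    poly f L x + 0ℚ                  ≡⟨ ℚ.+-identityʳ _ ⟩
    poly f L x                       ∎

  poly-recurrence : ∀ (D A P Q R : ℤ) (u₂ u₁ v₁ v₀ u₀ : ℕ → ℤ) →
    (∀ m → D ℤ.* u₂ m ≡ A ℤ.* (P ℤ.* u₁ m ℤ.- Q ℤ.* v₁ m) ℤ.+ R ℤ.* (v₀ m ℤ.- u₀ m)) → ∀ L x →
    ℤ→ℚ D * poly u₂ L x ≡
    ℤ→ℚ A * (ℤ→ℚ P * poly u₁ L x - ℤ→ℚ Q * poly v₁ L x) + ℤ→ℚ R * (poly v₀ L x - poly u₀ L x)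
  poly-recurrence D A P Q R u₂ u₁ v₁ v₀ u₀ rel L x =
    Σ<-recurrence L (x ^_) {ℤ→ℚ D} {ℤ→ℚ A} {ℤ→ℚ P} {ℤ→ℚ Q} {ℤ→ℚ R}
      (ℤ→ℚ ∘ u₂) (ℤ→ℚ ∘ u₁) (ℤ→ℚ ∘ v₁) (ℤ→ℚ ∘ v₀) (ℤ→ℚ ∘ u₀) cast
    where
    cast : ∀ m → ℤ→ℚ D * ℤ→ℚ (u₂ m) ≡
      ℤ→ℚ A * (ℤ→ℚ P * ℤ→ℚ (u₁ m) - ℤ→ℚ Q * ℤ→ℚ (v₁ m)) + ℤ→ℚ R * (ℤ→ℚ (v₀ m) - ℤ→ℚ (u₀ m))
    cast m = begin
      ℤ→ℚ D * ℤ→ℚ (u₂ m)                  ≡⟨ ℤ→ℚ-homo-* D (u₂ m) ⟨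
      ℤ→ℚ (D ℤ.* u₂ m)                    ≡⟨ cong ℤ→ℚ (rel m) ⟩
      ℤ→ℚ (A ℤ.* X ℤ.+ R ℤ.* Y)           ≡⟨ ℤ→ℚ-homo-+ (A ℤ.* X) (R ℤ.* Y) ⟩
      ℤ→ℚ (A ℤ.* X) + ℤ→ℚ (R ℤ.* Y)       ≡⟨ cong₂ _+_ (ℤ→ℚ-homo-* A X) (ℤ→ℚ-homo-* R Y) ⟩
      ℤ→ℚ A * ℤ→ℚ X + ℤ→ℚ R * ℤ→ℚ Y
        ≡⟨ cong₂ (λ X′ Y′ → ℤ→ℚ A * X′ + ℤ→ℚ R * Y′)
                 (trans (ℤ→ℚ-homo-− (P ℤ.* u₁ m) (Q ℤ.* v₁ m)) (cong₂ _-_ (ℤ→ℚ-homo-* P (u₁ m)) (ℤ→ℚ-homo-* Q (v₁ m))))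
                 (ℤ→ℚ-homo-− (v₀ m) (u₀ m)) ⟩
      ℤ→ℚ A * (ℤ→ℚ P * ℤ→ℚ (u₁ m) - ℤ→ℚ Q * ℤ→ℚ (v₁ m)) + ℤ→ℚ R * (ℤ→ℚ (v₀ m) - ℤ→ℚ (u₀ m)) ∎
      where
      X = P ℤ.* u₁ m ℤ.- Q ℤ.* v₁ m
      Y = v₀ m ℤ.- u₀ m

  2+j≤e⇒k+[1+j]≤e+K : ∀ K {e j} → suc (suc j) ≤ e → suc K ℕ.+ suc j ≤ e ℕ.+ K
  2+j≤e⇒k+[1+j]≤e+K K {e} {j} 2+j≤e = subst (_≤ e ℕ.+ K) (cong suc (ℕ.+-comm (suc j) K)) (ℕ.+-monoˡ-≤ K 2+j≤e)

  k+[1+j]≤e+K⇒2+j≤e : ∀ K {e j} → suc K ℕ.+ suc j ≤ e ℕ.+ K → suc (suc j) ≤ e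
  k+[1+j]≤e+K⇒2+j≤e K {e} {j} inside =
    ℕ.+-cancelʳ-≤ K (suc (suc j)) e (subst (_≤ e ℕ.+ K) (cong suc (ℕ.+-comm K (suc j))) inside)

  module _ (K : ℕ) where
    private
      k = suc K
      κ = ℕ→ℚ k

      vanishing : ∀ e m → weight K e m ≡ 0ℤ → κ * 0ℚ ≡ ℤ→ℚ (weight K e m)
      vanishing _ _ weight≡0 = trans (ℚ.*-zeroʳ κ) (cong ℤ→ℚ (sym weight≡0))

      interior : ∀ {e j} → suc (suc j) ≤ e →
        κ * (ℕ→ℚ (((e ℕ.+ K) C K) ℕ.* ((e ℕ.+ K ∸ k ∸ 1) C j) ℕ.* (k C suc j)) ÷ₜ κ) ≡ ℤ→ℚ (weight K e (suc j))
      interior {suc (suc e)} {j} (s≤s (s≤s _)) = begin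
        κ * (ℕ→ℚ X ÷ₜ κ)                                ≡⟨ q*[p÷ₜq]≡p (ℕ→ℚ X) (ℕ→ℚ[1+n]≢0 K) ⟩
        ℕ→ℚ X                                           ≡⟨ cong (λ t → ℕ→ℚ (c ℕ.* ((t ∸ 1) C j) ℕ.* z)) (ℕ.m+n∸n≡m (suc e) K) ⟩
        ℕ→ℚ (c ℕ.* (e C j) ℕ.* z)                       ≡⟨ cong (λ g → ℕ→ℚ (c ℕ.* g ℕ.* z)) (compositions-closed e j) ⟨
        ℕ→ℚ (c ℕ.* compositions (suc (suc e)) (suc j) ℕ.* z) ≡⟨ cong ℤ→ℚ (+-weight K (suc (suc e)) (suc j)) ⟩
        ℤ→ℚ (weight K (suc (suc e)) (suc j))            ∎
        where
        c = (suc (suc e) ℕ.+ K) C K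
        z = k C suc j
        X = c ℕ.* ((suc (suc e) ℕ.+ K ∸ k ∸ 1) C j) ℕ.* z

    -- Each `with` below matches on a decision made inside w, which reduces w to the matching branch.
    k*w≡weight : ∀ e m → κ * w (e ℕ.+ K) k m ≡ ℤ→ℚ (weight K e m)
    k*w≡weight zero zero with K ℕ.≟ k
    ... | yes K≡k = contradiction K≡k (ℕ.m≢1+n+m K)
    ... | no  _   = vanishing 0 0 (compositions≡0⇒weight≡0 K 0 0 refl)
    k*w≡weight (suc zero) zero with k ℕ.≟ k
    ... | no  k≢k = contradiction refl k≢k
    ... | yes _   = begin
      κ * 1ℚ                      ≡⟨ ℚ.*-identityʳ κ ⟩
      ℤ→ℚ (+ k)                   ≡⟨ cong ℤ→ℚ (ℤ.*-identityʳ (+ k)) ⟨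
      ℤ→ℚ (+ k ℤ.* + 1)           ≡⟨ cong (λ c → ℤ→ℚ (+ c ℤ.* + 1)) ([1+n]Cn≡1+n K) ⟨
      ℤ→ℚ (weight K 1 0)          ∎
    k*w≡weight (suc (suc e)) zero with suc (suc e) ℕ.+ K ℕ.≟ k
    ... | yes N≡k = contradiction (sym (cong ℕ.pred N≡k)) (ℕ.m≢1+n+m K)
    ... | no  _   = vanishing (suc (suc e)) 0 (compositions≡0⇒weight≡0 K (suc (suc e)) 0 refl)
    k*w≡weight e (suc j) with suc j ℕ.≤? k | k ℕ.+ suc j ℕ.≤? e ℕ.+ K
    ... | no  j≮k | _          = vanishing e (suc j) (C≡0⇒weight≡0 K e (suc j) (k>n⇒nCk≡0 (ℕ.≰⇒> j≮k)))
    ... | yes _   | no outside = vanishing e (suc j) (compositions≡0⇒weight≡0 K e (suc j)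
                                   (compositions-vanish (ℕ.≤-pred (ℕ.≰⇒> (outside ∘ 2+j≤e⇒k+[1+j]≤e+K K)))))
    ... | yes _   | yes inside = interior (k+[1+j]≤e+K⇒2+j≤e K inside)

    top-weight≡0 : ∀ e → weight K e (suc k) ≡ 0ℤ
    top-weight≡0 e = C≡0⇒weight≡0 K e (suc k) (k>n⇒nCk≡0 (ℕ.n<1+n k))

    k*W≡poly : ∀ e {N} x → N ≡ e ℕ.+ K → κ * W N k x ≡ poly (weight K e) (suc (suc k)) x
    k*W≡poly e x refl = begin
      κ * W (e ℕ.+ K) k x                              ≡⟨ cong (λ s → κ * sumℚ s) (map-upTo (λ m → w (e ℕ.+ K) k m * x ^ m) (suc k)) ⟩
      κ * Σ< (suc k) (λ m → w (e ℕ.+ K) k m * x ^ m)   ≡⟨ *-distribˡ-Σ< κ (suc k) (λ m → w (e ℕ.+ K) k m * x ^ m) ⟩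
      Σ< (suc k) (λ m → κ * (w (e ℕ.+ K) k m * x ^ m)) ≡⟨ Σ<-cong (suc k) (λ m → trans (sym (ℚ.*-assoc κ _ _)) (cong (_* x ^ m) (k*w≡weight e m))) ⟩
      poly (weight K e) (suc k) x                      ≡⟨ poly-top-zero (weight K e) (suc k) x (top-weight≡0 e) ⟨
      poly (weight K e) (suc (suc k)) x                ∎

    x*k*W≡poly-shift : ∀ e {N} x → N ≡ e ℕ.+ K → x * (κ * W N k x) ≡ poly (shift (weight K e)) (suc (suc k)) x
    x*k*W≡poly-shift e {N} x N≡e+K = begin
      x * (κ * W N k x)                            ≡⟨ cong (x *_) (k*W≡poly e x N≡e+K) ⟩
      x * poly (weight K e) (suc (suc k)) x        ≡⟨ cong (x *_) (poly-top-zero (weight K e) (suc k) x (top-weight≡0 e)) ⟩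
      x * poly (weight K e) (suc k) x              ≡⟨ poly-shift (weight K e) (suc k) x ⟨
      poly (shift (weight K e)) (suc (suc k)) x    ∎

  cleared-recurrence : ∀ K d x → let n = d ℕ.+ K; k = suc K; κ = ℕ→ℚ k in
    ℤ→ℚ (a n k ℤ.* a n k ℤ.* b n k) * (κ * W (n ℕ.+ 2) k x) ≡
    ℤ→ℚ (a n k) * (ℤ→ℚ (p₀ n k) * (κ * W (n ℕ.+ 1) k x) - ℤ→ℚ (p₁ n k) * (x * (κ * W (n ℕ.+ 1) k x)))
    + ℤ→ℚ (r n k) * (x * (κ * W n k x) - κ * W n k x)
  cleared-recurrence K d x = begin
    ℤ→ℚ (α ℤ.* α ℤ.* β) * (κ * W (n ℕ.+ 2) k x)
      ≡⟨ cong (ℤ→ℚ (α ℤ.* α ℤ.* β) *_) (k*W≡poly K (2 ℕ.+ d) x (ℕ.+-comm n 2)) ⟩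
    ℤ→ℚ (α ℤ.* α ℤ.* β) * poly (weight K (2 ℕ.+ d)) L x
      ≡⟨ poly-recurrence (α ℤ.* α ℤ.* β) α π₀ π₁ ρ (weight K (2 ℕ.+ d)) (weight K (1 ℕ.+ d)) (shift (weight K (1 ℕ.+ d)))
                       (shift (weight K d)) (weight K d) (weight-recurrence K d) L x ⟩
    ℤ→ℚ α * (ℤ→ℚ π₀ * poly (weight K (1 ℕ.+ d)) L x - ℤ→ℚ π₁ * poly (shift (weight K (1 ℕ.+ d))) L x)
    + ℤ→ℚ ρ * (poly (shift (weight K d)) L x - poly (weight K d) L x)
      ≡⟨ cong₂ _+_ (cong (ℤ→ℚ α *_) (cong₂ (λ u v → ℤ→ℚ π₀ * u - ℤ→ℚ π₁ * v)
                                           (k*W≡poly K (1 ℕ.+ d) x (ℕ.+-comm n 1))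
                                           (x*k*W≡poly-shift K (1 ℕ.+ d) x (ℕ.+-comm n 1))))
                   (cong (ℤ→ℚ ρ *_) (cong₂ _-_ (x*k*W≡poly-shift K d x refl) (k*W≡poly K d x refl))) ⟨
    ℤ→ℚ α * (ℤ→ℚ π₀ * (κ * W (n ℕ.+ 1) k x) - ℤ→ℚ π₁ * (x * (κ * W (n ℕ.+ 1) k x)))
    + ℤ→ℚ ρ * (x * (κ * W n k x) - κ * W n k x) ∎
    where
    n = d ℕ.+ K
    k = suc K
    κ = ℕ→ℚ k
    L = suc (suc k)
    α = a n k
    β = b n k
    π₀ = p₀ n k
    π₁ = p₁ n k
    ρ = r n k

  solve-for-W₂ : ∀ α δ₁ δ₂ κ π₀ π₁ ρ x W₀ W₁ W₂ → δ₁ ≢ 0ℚ → δ₂ ≢ 0ℚ → κ ≢ 0ℚ → δ₂ ≡ α * δ₁ →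
    δ₂ * (κ * W₂) ≡ α * (π₀ * (κ * W₁) - π₁ * (x * (κ * W₁))) + ρ * (x * (κ * W₀) - κ * W₀) →
    W₂ ≡ ((π₀ - π₁ * x) ÷ₜ δ₁) * W₁ + ((ρ * (x - 1ℚ)) ÷ₜ δ₂) * W₀
  solve-for-W₂ α δ₁ δ₂ κ π₀ π₁ ρ x W₀ W₁ W₂ δ₁≢0 δ₂≢0 κ≢0 δ₂≡αδ₁ rec = *-cancelˡ-≢0 κ≢0 (*-cancelˡ-≢0 δ₂≢0
    (cleared _ _ (q*[p÷ₜq]≡p (π₀ - π₁ * x) δ₁≢0) (q*[p÷ₜq]≡p (ρ * (x - 1ℚ)) δ₂≢0)))
    where
    cleared : ∀ u v → δ₁ * u ≡ π₀ - π₁ * x → δ₂ * v ≡ ρ * (x - 1ℚ) → δ₂ * (κ * W₂) ≡ δ₂ * (κ * (u * W₁ + v * W₀))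
    cleared u v δ₁u≡ δ₂v≡ = by-differenceℚ
      (cong₂ _-_ (cong₂ _-_ rec (cong (κ * u * W₁ *_) δ₂≡αδ₁))
                 (cong₂ _+_ (cong (α * κ * W₁ *_) δ₁u≡) (cong (κ * W₀ *_) δ₂v≡)))
      (solve (α ∷ δ₁ ∷ δ₂ ∷ κ ∷ π₀ ∷ π₁ ∷ ρ ∷ x ∷ u ∷ v ∷ W₀ ∷ W₁ ∷ W₂ ∷ []) ℚ-ring)

open Coefficients using (a; b; p₀; p₁; r; a≡1+d; b≡2+d)
open Rationals using (ℤ→ℚ-homo-*; i≢0⇒ℤ→ℚ≢0; ℕ→ℚ[1+n]≢0)
open Polynomials using (cleared-recurrence; solve-for-W₂)
open import Data.Integer as ℤ using (+_)
import Data.Integer.Properties as ℤ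
open import Data.Rational using (ℚ; _+_; _*_; _-_; 1ℚ)

theorem2p3 : (k : ℕ) → 1 ≤ k → (n : ℕ) → k ≤ n ℕ.+ 1 → (x : ℚ) →
    W (n ℕ.+ 2) k x ≡
      ((ℤ→ℚ (+ (n ℕ.+ 2) ℤ.* (+ 2 ℤ.* (+ n ℤ.- + k ℤ.+ + 1))) - ℤ→ℚ (+ (n ℕ.+ 2) ℤ.* (+ n ℤ.- + 2 ℤ.* + k ℤ.+ + 1)) * x)
        ÷ₜ ℤ→ℚ ((+ n ℤ.- + k ℤ.+ + 2) ℤ.* (+ n ℤ.- + k ℤ.+ + 3))) * W (n ℕ.+ 1) k x
      + ((ℤ→ℚ ((+ n ℤ.+ + 1) ℤ.* (+ n ℤ.+ + 2) ℤ.* (+ n ℤ.- + k)) * (x - 1ℚ))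
        ÷ₜ ℤ→ℚ ((+ n ℤ.- + k ℤ.+ + 2) ℤ.* (+ n ℤ.- + k ℤ.+ + 2) ℤ.* (+ n ℤ.- + k ℤ.+ + 3))) * W n k x
theorem2p3 (suc K) _ n k≤n+1 x
  with (∃ λ d → d ℕ.+ K ≡ n) ∋ (n ∸ K , ℕ.m∸n+n≡m (ℕ.≤-pred (subst (suc K ≤_) (ℕ.+-comm n 1) k≤n+1)))
... | d , refl =
  solve-for-W₂ (ℤ→ℚ α) (ℤ→ℚ (α ℤ.* β)) (ℤ→ℚ (α ℤ.* α ℤ.* β)) (ℕ→ℚ k) (ℤ→ℚ (p₀ n k)) (ℤ→ℚ (p₁ n k)) (ℤ→ℚ (r n k))
               x (W n k x) (W (n ℕ.+ 1) k x) (W (n ℕ.+ 2) k x)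
               (i≢0⇒ℤ→ℚ≢0 ab≢0) (i≢0⇒ℤ→ℚ≢0 aab≢0) (ℕ→ℚ[1+n]≢0 K)
               (trans (cong ℤ→ℚ (ℤ.*-assoc α α β)) (ℤ→ℚ-homo-* α (α ℤ.* β)))
               (cleared-recurrence K d x)
  where
  k = suc K
  α = a n k
  β = b n k
  ab≢0 : α ℤ.* β ≢ + 0
  ab≢0 rewrite a≡1+d d K | b≡2+d d K = λ ()
  aab≢0 : α ℤ.* α ℤ.* β ≢ + 0
  aab≢0 rewrite a≡1+d d K | b≡2+d d K = λ ()
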